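{- Let $G$ be a finite group and $N$ a normal subgroup of $G$. Then the right regular representation of $G$ is self-normalizing in $W(G,N)$ if and only if (1) $Z(N) \le Z(G)$, and (2) the order of the abelianization of $G/N$ is relatively prime to $|Z(N)|$.
   Context: Let $\overline{\phantom{x}}\colon G \to G/N$ be the natural homomorphism. For $c \in G$ and any function $f\colon G/N \to N$, let $\varphi_{c,f}$ be the permutation of $G$ given by $\varphi_{c,f}(x) = x c\, f(\overline{x})$. $W(G,N)$ is the set of all such permutations $\varphi_{c,f}$; it is a subgroup of the symmetric group on $G$ containing the right regular representation of $G$ (the action of $G$ on itself by right multiplication). $Z(\cdot)$ denotes the center. -}

module Defs where

open import Level using (0ℓ)
open import Data.Nat using (ℕ)
open import Data.Fin using (Fin)
open import Data.Product using (Σ; ∃; _×_; _,_)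
open import Relation.Binary.PropositionalEquality using (_≡_)
open import Algebra.Structures using (IsGroup)

record FiniteGroup : Set₁ where
  infixl 7 _∙_
  field
    Carrier : Set
    _∙_     : Carrier → Carrier → Carrier
    ε       : Carrier
    _⁻¹     : Carrier → Carrier
    isGroup : IsGroup _≡_ _∙_ ε _⁻¹
    order   : ℕ
    enum    : Fin order → Carrier
    enum-injective  : ∀ i j → enum i ≡ enum j → i ≡ j
    enum-surjective : ∀ x → ∃ λ i → enum i ≡ x

module _ (G : FiniteGroup) where
  open FiniteGroup G

  commutator : Carrier → Carrier → Carrier
  commutator a b = a ⁻¹ ∙ b ⁻¹ ∙ a ∙ b

  record NormalSubgroup : Set₁ where
    field
      _∈N    : Carrier → Set
      ε∈     : ε ∈N
      ∙∈     : ∀ {x y} → x ∈N → y ∈N → (x ∙ y) ∈N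
      ⁻¹∈    : ∀ {x} → x ∈N → (x ⁻¹) ∈N
      normal : ∀ g {x} → x ∈N → (g ∙ x ∙ g ⁻¹) ∈N

  -- cardinality of the quotient of a predicate P by a relation R
  -- (with R = _≡_ this is the ordinary cardinality of the subset P):
  -- there is an enumeration of k elements of P, pairwise R-inequivalent,
  -- meeting every R-class of P.
  HasCard : (R : Carrier → Carrier → Set) (P : Carrier → Set) → ℕ → Set
  HasCard R P k =
    Σ (Fin k → Carrier) λ e →
      (∀ i → P (e i)) ×
      (∀ i j → R (e i) (e j) → i ≡ j) ×
      (∀ x → P x → ∃ λ i → R x (e i))

  InZG : Carrier → Set
  InZG z = ∀ g → z ∙ g ≡ g ∙ z

  ρ : Carrier → Carrier → Carrier
  ρ g x = x ∙ g

  module _ (N : NormalSubgroup) where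
    open NormalSubgroup N

    InZN : Carrier → Set
    InZN z = z ∈N × (∀ n → n ∈N → z ∙ n ≡ n ∙ z)

    -- equality in G/N of the cosets of x and y
    _~N_ : Carrier → Carrier → Set
    x ~N y = (x ⁻¹ ∙ y) ∈N

    -- membership of the coset of x in the derived subgroup [G/N , G/N]
    -- of G/N (the subgroup of G/N generated by commutators of G/N),
    -- expressed on representatives.
    data InDerivedQ : Carrier → Set where
      gen : ∀ {x} a b → x ~N commutator a b → InDerivedQ x
      one : ∀ {x} → x ~N ε → InDerivedQ x
      mul : ∀ {x a b} → InDerivedQ a → InDerivedQ b → x ~N (a ∙ b) → InDerivedQ x
      inv : ∀ {x a} → InDerivedQ a → x ~N (a ⁻¹) → InDerivedQ x

    -- equality in the abelianization (G/N)/[G/N , G/N] of G/N,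
    -- on representatives in G
    _~Ab_ : Carrier → Carrier → Set
    x ~Ab y = InDerivedQ (x ⁻¹ ∙ y)

    -- the permutation φ_{c,f}(x) = x c f(x̄); a function f : G/N → N is
    -- given by a function on representatives, constant on cosets, with values in N
    IsQuotFun : (Carrier → Carrier) → Set
    IsQuotFun f = (∀ x → f x ∈N) × (∀ x y → x ~N y → f x ≡ f y)

    φ : Carrier → (Carrier → Carrier) → Carrier → Carrier
    φ c f x = x ∙ c ∙ f x

    -- σ normalizes the right regular representation R:
    -- σ R σ⁻¹ = R, i.e. σ ∘ ρ g = ρ h ∘ σ relates every g to some h and vice versa
    NormalizesR : (Carrier → Carrier) → Set
    NormalizesR σ =
      (∀ g → ∃ λ h → ∀ x → σ (ρ g x) ≡ ρ h (σ x)) ×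
      (∀ h → ∃ λ g → ∀ x → σ (ρ g x) ≡ ρ h (σ x))

    -- R is self-normalizing in W(G,N): every element of W(G,N)
    -- normalizing R already lies in R
    SelfNormalizingInW : Set
    SelfNormalizingInW =
      ∀ c f → IsQuotFun f → NormalizesR (φ c f) →
        ∃ λ g → ∀ x → φ c f x ≡ ρ g x

module Submission where

-- Write k = c f(1) and u(x) = c f(x) k⁻¹, so that φ_{c,f}(x) = x u(x) k. If φ_{c,f} normalizes
-- the right regular representation, u maps G into Z(N), is constant on cosets of N and satisfies
-- g u(x g) = u(x) g u(g); once Z(N) ≤ Z(G) this makes u a homomorphism from the abelianization of
-- G/N to Z(N), which is trivial when the two orders are coprime, so φ_{c,f} = ρ_k.
-- Conversely, for a ∈ Z(N) left multiplication by a is φ_{1,f} with f(x) = x⁻¹ a x and commutes with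
-- R, so it must be some ρ_g, forcing a ∈ Z(G). And a prime q dividing both orders gives a nontrivial
-- homomorphism χ : (G/N)^ab → Z(N): Cauchy provides w ∈ Z(N) of order q, and χ is built by induction
-- on the order, quotienting by a cyclic subgroup ⟨y⟩ of order q; when q does not divide the order
-- k of the quotient, x ↦ x^k lands in ⟨y⟩ ≅ ⟨w⟩. Then x ↦ x χ(x) normalizes R without lying in it.

open import Level using (0ℓ; _⊔_)
open import Data.Nat
  using (ℕ; zero; suc; pred; _+_; _*_; _∸_; _≤_; _<_; _%_; _/_; z≤n; s≤s;
         NonZero; >-nonZero; ≢-nonZero; ≢-nonZero⁻¹; nonTrivial⇒n>1)
import Data.Nat.Properties as ℕ
open import Data.Nat.DivMod using (m%n<n; m≡m%n+[m/n]*n; m*n%n≡0)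
open import Data.Nat.Divisibility using (_∣_; _∣?_; divides; m%n≡0⇒n∣m; ∣-trans; m∣m*n; 0∣⇒≡0; ∣1⇒≡1)
open import Data.Nat.GCD using (module Bézout)
open import Data.Nat.Coprimality using (Coprime; coprime-Bézout; prime⇒coprime)
open import Data.Nat.Primality using (Prime; ¬prime[0]; prime⇒irreducible; prime⇒nonTrivial; euclidsLemma)
open import Data.Nat.Primality.Factorisation using (factorise)
open import Data.Nat.ListAction using (product)
open import Data.Nat.Induction using (<-wellFounded)
open import Induction.WellFounded using (Acc; acc)
open import Data.List using ([]; _∷_)
open import Data.List.Relation.Unary.All using (_∷_)
open import Data.Fin using (Fin; zero; suc; toℕ; fromℕ; fromℕ<; remQuot; combine)
import Data.Fin.Properties as Fin
open import Data.Product using (Σ; ∃; _×_; _,_; proj₁; proj₂; uncurry)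
open import Data.Sum using (inj₁; inj₂)
open import Data.Empty using (⊥; ⊥-elim)
open import Data.Unit using (⊤; tt)
open import Function using (_∘_; _⇔_; mk⇔; Equivalence)
open import Relation.Nullary using (¬_; ¬?; yes; no; decidable-stable)
open import Relation.Binary using (Rel; Setoid; Decidable; tri<; tri≈; tri>)
open import Relation.Binary.PropositionalEquality as ≡ using (_≡_; _≢_)
open import Algebra.Bundles using (AbelianGroup; Group)
open import Algebra.Structures using (IsCommutativeMonoid; IsGroup)
open import Algebra.Morphism.Structures using (module MagmaMorphisms)

open import Defs

prime∤⇒coprime : ∀ {p n} → Prime p → ¬ p ∣ n → Coprime p n
prime∤⇒coprime p-prime p∤n (d∣p , d∣n) with prime⇒irreducible p-prime d∣p
... | inj₁ d≡1 = d≡1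
... | inj₂ ≡.refl = ⊥-elim (p∤n d∣n)

no-common-prime⇒coprime : ∀ {a b} .{{_ : NonZero a}} →
  (∀ {q} → Prime q → q ∣ a → q ∣ b → ⊥) → Coprime a b
no-common-prime⇒coprime {a} {b} no-common {d} (d∣a , d∣b) with d ℕ.≟ 1
... | yes d≡1 = d≡1
... | no d≢1 with factorise d {{≢-nonZero (λ { ≡.refl → ≢-nonZero⁻¹ a (0∣⇒≡0 d∣a) }) }}
...   | record { factors = [] ; isFactorisation = d≡1 } = ⊥-elim (d≢1 d≡1)
...   | record { factors = q ∷ qs ; isFactorisation = d≡qqs ; factorsPrime = q-prime ∷ _ } =
  ⊥-elim (no-common q-prime (∣-trans q∣d d∣a) (∣-trans q∣d d∣b))
  where
  q∣d : q ∣ d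
  q∣d = ≡.subst (q ∣_) (≡.sym d≡qqs) (m∣m*n (product qs))

module _ {c ℓ} (S : Setoid c ℓ) where
  open Setoid S

  IsEnumeration : ∀ {n} → (Fin n → Carrier) → Set (c ⊔ ℓ)
  IsEnumeration e = (∀ i j → e i ≈ e j → i ≡ j) × (∀ x → ∃ λ i → x ≈ e i)

  private
    indices-injective : ∀ {m n} {e : Fin m → Carrier} {e′ : Fin n → Carrier} →
      (∀ i j → e i ≈ e j → i ≡ j) → (cover : ∀ x → ∃ λ i → x ≈ e′ i) →
      ∀ {i j} → proj₁ (cover (e i)) ≡ proj₁ (cover (e j)) → i ≡ j
    indices-injective {e = e} {e′} inj cover {i} {j} p =
      inj i j (trans (proj₂ (cover (e i))) (trans (reflexive (≡.cong e′ p)) (sym (proj₂ (cover (e j))))))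

  enumeration-size-unique : ∀ {m n} {e : Fin m → Carrier} {e′ : Fin n → Carrier} →
    IsEnumeration e → IsEnumeration e′ → m ≡ n
  enumeration-size-unique (inj , surj) (inj′ , surj′) =
    Fin.cantor-schröder-bernstein (indices-injective inj surj′) (indices-injective inj′ surj)

  record Representatives {n} (e : Fin n → Carrier) : Set (c ⊔ ℓ) where
    field
      count         : ℕ
      rep           : Fin count → Carrier
      rep-injective : ∀ i j → rep i ≈ rep j → i ≡ j
      rep-cover     : ∀ i → ∃ λ j → e i ≈ rep j

  representatives : Decidable _≈_ → ∀ {n} (e : Fin n → Carrier) → Representatives e
  representatives _≟_ {zero} e = record { count = 0 ; rep = λ () ; rep-injective = λ () ; rep-cover = λ () }
  representatives _≟_ {suc n} e with representatives _≟_ (e ∘ suc)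
  ... | record { count = k ; rep = r ; rep-injective = r-inj ; rep-cover = r-cover }
    with Fin.any? (λ j → e zero ≟ r j)
  ...   | yes (j , e₀≈rⱼ) = record { count = k ; rep = r ; rep-injective = r-inj ; rep-cover = cover }
    where
    cover : ∀ i → ∃ λ j → e i ≈ r j
    cover zero = j , e₀≈rⱼ
    cover (suc i) = r-cover i
  ...   | no e₀≉r = record { count = suc k ; rep = r′ ; rep-injective = r′-inj ; rep-cover = cover }
    where
    r′ : Fin (suc k) → Carrier
    r′ zero = e zero
    r′ (suc j) = r j
    r′-inj : ∀ i j → r′ i ≈ r′ j → i ≡ j
    r′-inj zero zero _ = ≡.refl
    r′-inj zero (suc j) p = ⊥-elim (e₀≉r (j , p))
    r′-inj (suc i) zero p = ⊥-elim (e₀≉r (i , sym p))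
    r′-inj (suc i) (suc j) p = ≡.cong suc (r-inj i j p)
    cover : ∀ i → ∃ λ j → e i ≈ r′ j
    cover zero = zero , refl
    cover (suc i) = let j , p = r-cover i in suc j , p

-- Finite abelian groups, powers and orders

record FiniteAbelianGroup : Set₁ where
  field
    abelianGroup : AbelianGroup 0ℓ 0ℓ
  open AbelianGroup abelianGroup public
  field
    size : ℕ
    enum : Fin size → Carrier
    isEnumeration : IsEnumeration setoid enum

module _ {A : Set} {_≈_ : Rel A 0ℓ} where
  open import Algebra.Definitions _≈_ using (LeftIdentity; LeftInverse; Commutative; Congruent₁)
  open import Algebra.Structures _≈_ using (IsSemigroup; IsAbelianGroup)
  open import Algebra.Structures.Biased _≈_ using (isCommutativeMonoidˡ)

  -- With commutativity the right laws follow from the left ones, and inversion is then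
  -- automatically a congruence.
  record IsAbelianGroupˡ (_∙_ : A → A → A) (ε : A) (_⁻¹ : A → A) : Set where
    field
      isSemigroup : IsSemigroup _∙_
      identityˡ   : LeftIdentity ε _∙_
      inverseˡ    : LeftInverse ε _⁻¹ _∙_
      comm        : Commutative _∙_

    open IsSemigroup isSemigroup
    open import Relation.Binary.Reasoning.Setoid setoid

    inverseʳ : ∀ x → (x ∙ (x ⁻¹)) ≈ ε
    inverseʳ x = trans (comm x (x ⁻¹)) (inverseˡ x)

    ⁻¹-cong : Congruent₁ _⁻¹
    ⁻¹-cong {x} {y} x≈y = begin
      x ⁻¹                      ≈⟨ identityˡ (x ⁻¹) ⟨
      ε ∙ (x ⁻¹)                ≈⟨ ∙-congʳ (inverseˡ y) ⟨
      ((y ⁻¹) ∙ y) ∙ (x ⁻¹)     ≈⟨ assoc (y ⁻¹) y (x ⁻¹) ⟩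
      (y ⁻¹) ∙ (y ∙ (x ⁻¹))     ≈⟨ ∙-congˡ (∙-congʳ x≈y) ⟨
      (y ⁻¹) ∙ (x ∙ (x ⁻¹))     ≈⟨ ∙-congˡ (inverseʳ x) ⟩
      (y ⁻¹) ∙ ε                ≈⟨ comm (y ⁻¹) ε ⟩
      ε ∙ (y ⁻¹)                ≈⟨ identityˡ (y ⁻¹) ⟩
      y ⁻¹                      ∎

    isAbelianGroup : IsAbelianGroup _∙_ ε _⁻¹
    isAbelianGroup = record
      { isGroup = record
        { isMonoid = IsCommutativeMonoid.isMonoid cm
        ; inverse = inverseˡ , inverseʳ
        ; ⁻¹-cong = ⁻¹-cong
        }
      ; comm = comm
      }
      where
      cm : IsCommutativeMonoid _≈_ _∙_ ε
      cm = isCommutativeMonoidˡ (record { isSemigroup = isSemigroup ; identityˡ = identityˡ ; comm = comm })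

  open IsAbelianGroupˡ public using () renaming (isAbelianGroup to isAbelianGroupˡ)

module FiniteAbelianGroupProperties (A : FiniteAbelianGroup) where
  open FiniteAbelianGroup A
  open import Algebra.Properties.Group group using (∙-cancelʳ; identityˡ-unique)
  open import Algebra.Properties.CommutativeMonoid.Mult commutativeMonoid
    using (×-congʳ; ×-homo-+; ×-assocˡ; ×-distrib-+) renaming (_×_ to _·ⁿ_)
  open import Relation.Binary.Reasoning.Setoid setoid

  enum-injective : ∀ i j → enum i ≈ enum j → i ≡ j
  enum-injective = proj₁ isEnumeration

  enum-surjective : ∀ x → ∃ λ i → x ≈ enum i
  enum-surjective = proj₂ isEnumeration

  index : Carrier → Fin size
  index x = proj₁ (enum-surjective x)

  infix 4 _≟_
  _≟_ : Decidable _≈_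
  x ≟ y with enum-surjective x | enum-surjective y
  ... | i , x≈eᵢ | j , y≈eⱼ with i Fin.≟ j
  ...   | yes ≡.refl = yes (trans x≈eᵢ (sym y≈eⱼ))
  ...   | no i≢j = no λ x≈y → i≢j (enum-injective i j (trans (sym x≈eᵢ) (trans x≈y y≈eⱼ)))

  nontrivial-element : size ≢ 1 → ∃ λ x → ¬ x ≈ ε
  nontrivial-element size≢1 with Fin.any? (λ i → ¬? (enum i ≟ ε))
  ... | yes (i , eᵢ≉ε) = enum i , eᵢ≉ε
  ... | no none = ⊥-elim (size≢1 (enumeration-size-unique setoid isEnumeration trivial-enumeration))
    where
    trivial-enumeration : IsEnumeration setoid {1} (λ _ → ε)
    trivial-enumeration = (λ { zero zero _ → ≡.refl }) , λ x →
      let i , x≈eᵢ = enum-surjective x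
      in zero , trans x≈eᵢ (decidable-stable (enum i ≟ ε) (λ eᵢ≉ε → none (i , eᵢ≉ε)))

  size>0 : 0 < size
  size>0 with index ε
  ... | zero = s≤s z≤n
  ... | suc _ = s≤s z≤n

  infixr 8 _^_
  _^_ : Carrier → ℕ → Carrier
  x ^ n = n ·ⁿ x

  ^-cong : ∀ {x y} n → x ≈ y → x ^ n ≈ y ^ n
  ^-cong n = ×-congʳ n

  ^-+ : ∀ x m n → x ^ (m + n) ≈ x ^ m ∙ x ^ n
  ^-+ = ×-homo-+

  ^-* : ∀ x m n → x ^ (m * n) ≈ (x ^ n) ^ m
  ^-* x m n = sym (×-assocˡ x m n)

  ^-distrib-∙ : ∀ x y n → (x ∙ y) ^ n ≈ x ^ n ∙ y ^ n
  ^-distrib-∙ = ×-distrib-+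

  ^-comm : ∀ x m n → (x ^ m) ^ n ≈ (x ^ n) ^ m
  ^-comm x m n = trans (sym (^-* x n m)) (trans (reflexive (≡.cong (x ^_) (ℕ.*-comm n m))) (^-* x m n))

  ε^n≈ε : ∀ n → ε ^ n ≈ ε
  ε^n≈ε zero = refl
  ε^n≈ε (suc n) = trans (identityˡ (ε ^ n)) (ε^n≈ε n)

  ^≈ε⇒^*≈ε : ∀ {x m} → x ^ m ≈ ε → ∀ t → x ^ (t * m) ≈ ε
  ^≈ε⇒^*≈ε {x} {m} xᵐ≈ε t = trans (^-* x t m) (trans (^-cong t xᵐ≈ε) (ε^n≈ε t))

  ^%≈^ : ∀ {x m} .{{_ : NonZero m}} → x ^ m ≈ ε → ∀ i → x ^ (i % m) ≈ x ^ i
  ^%≈^ {x} {m} xᵐ≈ε i = begin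
    x ^ (i % m)                        ≈⟨ identityʳ _ ⟨
    x ^ (i % m) ∙ ε                    ≈⟨ ∙-congˡ (^≈ε⇒^*≈ε xᵐ≈ε (i / m)) ⟨
    x ^ (i % m) ∙ x ^ ((i / m) * m)    ≈⟨ ^-+ x (i % m) ((i / m) * m) ⟨
    x ^ (i % m + (i / m) * m)          ≡⟨ ≡.cong (x ^_) (m≡m%n+[m/n]*n i m) ⟨
    x ^ i                              ∎

  ^-inverse : ∀ {x m} .{{_ : NonZero m}} → x ^ m ≈ ε → ∀ s → x ^ s ∙ x ^ (s * pred m) ≈ ε
  ^-inverse {x} {m} xᵐ≈ε s = begin
    x ^ s ∙ x ^ (s * pred m)    ≈⟨ ^-+ x s (s * pred m) ⟨
    x ^ (s + s * pred m)        ≡⟨ ≡.cong (x ^_) (ℕ.*-suc s (pred m)) ⟨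
    x ^ (s * suc (pred m))      ≡⟨ ≡.cong (λ n → x ^ (s * n)) (ℕ.suc-pred m) ⟩
    x ^ (s * m)                 ≈⟨ ^≈ε⇒^*≈ε xᵐ≈ε s ⟩
    ε                           ∎

  ^-cancel : ∀ x d i → x ^ (d + i) ≈ x ^ i → x ^ d ≈ ε
  ^-cancel x d i xᵈ⁺ⁱ≈xⁱ = ∙-cancelʳ (x ^ i) (x ^ d) ε (begin
    x ^ d ∙ x ^ i    ≈⟨ ^-+ x d i ⟨
    x ^ (d + i)      ≈⟨ xᵈ⁺ⁱ≈xⁱ ⟩
    x ^ i            ≈⟨ identityˡ (x ^ i) ⟨
    ε ∙ x ^ i        ∎)

  consecutive-exponents⇒≈ε : ∀ {x} k → x ^ k ≈ ε → x ^ suc k ≈ ε → x ≈ ε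
  consecutive-exponents⇒≈ε {x} k xᵏ≈ε x¹⁺ᵏ≈ε = identityˡ-unique x (x ^ k) (trans x¹⁺ᵏ≈ε (sym xᵏ≈ε))

  coprime-exponents⇒≈ε : ∀ {x a b} → x ^ a ≈ ε → x ^ b ≈ ε → Coprime a b → x ≈ ε
  coprime-exponents⇒≈ε {x} {a} {b} xᵃ≈ε xᵇ≈ε a⊥b with coprime-Bézout a⊥b
  ... | Bézout.+- s t 1+tb≡sa = consecutive-exponents⇒≈ε (t * b) (^≈ε⇒^*≈ε xᵇ≈ε t)
          (trans (reflexive (≡.cong (x ^_) 1+tb≡sa)) (^≈ε⇒^*≈ε xᵃ≈ε s))
  ... | Bézout.-+ s t 1+sa≡tb = consecutive-exponents⇒≈ε (s * a) (^≈ε⇒^*≈ε xᵃ≈ε s)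
          (trans (reflexive (≡.cong (x ^_) 1+sa≡tb)) (^≈ε⇒^*≈ε xᵇ≈ε t))

  -- For prime q this is an element of order q (see isOrder-prime).
  HasElementOfOrder : ℕ → Set
  HasElementOfOrder q = ∃ λ y → y ^ q ≈ ε × ¬ y ≈ ε

  record IsOrder (x : Carrier) (m : ℕ) : Set where
    field
      positive    : 0 < m
      annihilates : x ^ m ≈ ε
      minimal     : ∀ k → 0 < k → k < m → ¬ x ^ k ≈ ε

    instance
      nonZero : NonZero m
      nonZero = >-nonZero positive

    ^-distinct : ∀ {i j} → i < j → j < m → ¬ x ^ i ≈ x ^ j
    ^-distinct {i} {j} i<j j<m xⁱ≈xʲ = minimal (j ∸ i) (ℕ.m<n⇒0<n∸m i<j) (ℕ.≤-<-trans (ℕ.m∸n≤m j i) j<m)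
      (^-cancel x (j ∸ i) i (trans (reflexive (≡.cong (x ^_) (ℕ.m∸n+n≡m (ℕ.<⇒≤ i<j)))) (sym xⁱ≈xʲ)))

    ^-injective : ∀ {i j} → i < m → j < m → x ^ i ≈ x ^ j → i ≡ j
    ^-injective {i} {j} i<m j<m xⁱ≈xʲ with ℕ.<-cmp i j
    ... | tri< i<j _ _ = ⊥-elim (^-distinct i<j j<m xⁱ≈xʲ)
    ... | tri≈ _ i≡j _ = i≡j
    ... | tri> _ _ j<i = ⊥-elim (^-distinct j<i i<m (sym xⁱ≈xʲ))

    ^≈^⇔%≡% : ∀ i j → x ^ i ≈ x ^ j ⇔ i % m ≡ j % m
    ^≈^⇔%≡% i j = mk⇔
      (λ xⁱ≈xʲ → ^-injective (m%n<n i m) (m%n<n j m)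
        (trans (^%≈^ annihilates i) (trans xⁱ≈xʲ (sym (^%≈^ annihilates j)))))
      (λ i%m≡j%m → trans (sym (^%≈^ annihilates i))
        (trans (reflexive (≡.cong (x ^_) i%m≡j%m)) (^%≈^ annihilates j)))

    order-∣ : ∀ {k} → x ^ k ≈ ε → m ∣ k
    order-∣ {k} xᵏ≈ε = m%n≡0⇒n∣m k m (≡.trans (Equivalence.to (^≈^⇔%≡% k 0) xᵏ≈ε) (m*n%n≡0 0 m))

  private
    positive-annihilator : ∀ x → ∃ λ K → 0 < K × x ^ K ≈ ε
    positive-annihilator x
      with i , j , i<j , same-index ← Fin.pigeonhole (ℕ.n<1+n size) (λ (i : Fin (suc size)) → index (x ^ toℕ i))
      = toℕ j ∸ toℕ i , ℕ.m<n⇒0<n∸m (Fin.toℕ-mono-< i<j) , ^-cancel x (toℕ j ∸ toℕ i) (toℕ i) (begin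
          x ^ (toℕ j ∸ toℕ i + toℕ i)   ≡⟨ ≡.cong (x ^_) (ℕ.m∸n+n≡m (ℕ.<⇒≤ (Fin.toℕ-mono-< i<j))) ⟩
          x ^ toℕ j                     ≈⟨ proj₂ (enum-surjective _) ⟩
          enum (index (x ^ toℕ j))      ≡⟨ ≡.cong enum same-index ⟨
          enum (index (x ^ toℕ i))      ≈⟨ proj₂ (enum-surjective _) ⟨
          x ^ toℕ i                     ∎)

    least-annihilator : ∀ x K → x ^ suc K ≈ ε → ∃ (IsOrder x)
    least-annihilator x K xᴷ≈ε
      with i , ¬¬xⁱ≈ε , below ← Fin.¬∀⟶∃¬-smallest (suc K) (λ i → ¬ x ^ suc (toℕ i) ≈ ε)
             (λ i → ¬? (x ^ suc (toℕ i) ≟ ε))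
             (λ none → none (fromℕ K) (≡.subst (λ n → x ^ suc n ≈ ε) (≡.sym (Fin.toℕ-fromℕ K)) xᴷ≈ε))
      = suc (toℕ i) , record
        { positive = s≤s z≤n
        ; annihilates = decidable-stable (x ^ suc (toℕ i) ≟ ε) ¬¬xⁱ≈ε
        ; minimal = minimal
        }
      where
      minimal : ∀ k → 0 < k → k < suc (toℕ i) → ¬ x ^ k ≈ ε
      minimal (suc k) _ (s≤s k<i) = ≡.subst (λ n → ¬ x ^ suc n ≈ ε)
        (≡.trans (Fin.toℕ-inject (fromℕ< k<i)) (Fin.toℕ-fromℕ< k<i)) (below (fromℕ< k<i))

  order : ∀ x → ∃ (IsOrder x)
  order x with positive-annihilator x
  ... | suc K , _ , xᴷ≈ε = least-annihilator x K xᴷ≈ε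

  isOrder-prime : ∀ {x q} → Prime q → x ^ q ≈ ε → ¬ x ≈ ε → IsOrder x q
  isOrder-prime {x} {q} q-prime xᵠ≈ε x≉ε = record
    { positive = ℕ.n≢0⇒n>0 (λ { ≡.refl → ¬prime[0] q-prime })
    ; annihilates = xᵠ≈ε
    ; minimal = λ k 0<k k<q xᵏ≈ε →
        x≉ε (coprime-exponents⇒≈ε xᵠ≈ε xᵏ≈ε (prime⇒coprime q-prime {{>-nonZero 0<k}} k<q))
    }

  nontrivial⇒order≥2 : ∀ {x m} → ¬ x ≈ ε → IsOrder x m → 2 ≤ m
  nontrivial⇒order≥2 {x} {m} x≉ε o with IsOrder.positive o
  ... | s≤s {n = zero} z≤n = ⊥-elim (x≉ε (trans (sym (identityʳ x)) (IsOrder.annihilates o)))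
  ... | s≤s {n = suc _} z≤n = s≤s (s≤s z≤n)

-- Quotients by cyclic subgroups and Lagrange's theorem

module CyclicQuotient (A : FiniteAbelianGroup) {x : FiniteAbelianGroup.Carrier A} {m : ℕ}
  (o : FiniteAbelianGroupProperties.IsOrder A x m) where
  open FiniteAbelianGroup A
  open FiniteAbelianGroupProperties A
  open IsOrder o
  open import Algebra.Properties.CommutativeSemigroup commutativeSemigroup using (interchange)
  open import Relation.Binary.Reasoning.Setoid setoid

  infix 4 _≈ₓ_
  _≈ₓ_ : Rel Carrier 0ℓ
  a ≈ₓ b = ∃ λ t → a ≈ b ∙ x ^ t

  ≈⇒≈ₓ : ∀ {a b} → a ≈ b → a ≈ₓ b
  ≈⇒≈ₓ {a} {b} a≈b = 0 , trans a≈b (sym (identityʳ b))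

  ∙^≈∙^⇒≈ₓ : ∀ {a b} s t → a ∙ x ^ s ≈ b ∙ x ^ t → a ≈ₓ b
  ∙^≈∙^⇒≈ₓ {a} {b} s t axˢ≈bxᵗ = t + s * pred m , (begin
    a                                ≈⟨ identityʳ a ⟨
    a ∙ ε                            ≈⟨ ∙-congˡ (^-inverse annihilates s) ⟨
    a ∙ (x ^ s ∙ x ^ (s * pred m))   ≈⟨ assoc a _ _ ⟨
    (a ∙ x ^ s) ∙ x ^ (s * pred m)   ≈⟨ ∙-congʳ axˢ≈bxᵗ ⟩
    (b ∙ x ^ t) ∙ x ^ (s * pred m)   ≈⟨ assoc b _ _ ⟩
    b ∙ (x ^ t ∙ x ^ (s * pred m))   ≈⟨ ∙-congˡ (^-+ x t (s * pred m)) ⟨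
    b ∙ x ^ (t + s * pred m)         ∎)

  ≈ₓ-sym : ∀ {a b} → a ≈ₓ b → b ≈ₓ a
  ≈ₓ-sym {a} {b} (t , a≈bxᵗ) = ∙^≈∙^⇒≈ₓ t 0 (trans (sym a≈bxᵗ) (sym (identityʳ a)))

  ≈ₓ-trans : ∀ {a b c} → a ≈ₓ b → b ≈ₓ c → a ≈ₓ c
  ≈ₓ-trans {a} {b} {c} (s , a≈bxˢ) (t , b≈cxᵗ) = t + s , (begin
    a                    ≈⟨ a≈bxˢ ⟩
    b ∙ x ^ s            ≈⟨ ∙-congʳ b≈cxᵗ ⟩
    (c ∙ x ^ t) ∙ x ^ s  ≈⟨ assoc c _ _ ⟩
    c ∙ (x ^ t ∙ x ^ s)  ≈⟨ ∙-congˡ (^-+ x t s) ⟨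
    c ∙ x ^ (t + s)      ∎)

  ∙-congₓ : ∀ {a a′ b b′} → a ≈ₓ a′ → b ≈ₓ b′ → a ∙ b ≈ₓ a′ ∙ b′
  ∙-congₓ {a} {a′} {b} {b′} (s , a≈a′xˢ) (t , b≈b′xᵗ) = s + t , (begin
    a ∙ b                          ≈⟨ ∙-cong a≈a′xˢ b≈b′xᵗ ⟩
    (a′ ∙ x ^ s) ∙ (b′ ∙ x ^ t)    ≈⟨ interchange a′ (x ^ s) b′ (x ^ t) ⟩
    (a′ ∙ b′) ∙ (x ^ s ∙ x ^ t)    ≈⟨ ∙-congˡ (^-+ x s t) ⟨
    (a′ ∙ b′) ∙ x ^ (s + t)        ∎)

  _≟ₓ_ : Decidable _≈ₓ_
  a ≟ₓ b with Fin.any? (λ (t : Fin m) → a ≟ b ∙ x ^ toℕ t)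
  ... | yes (t , a≈bxᵗ) = yes (toℕ t , a≈bxᵗ)
  ... | no none = no λ (t , a≈bxᵗ) → none (fromℕ< (m%n<n t m) , (begin
    a                                ≈⟨ a≈bxᵗ ⟩
    b ∙ x ^ t                        ≈⟨ ∙-congˡ (^%≈^ annihilates t) ⟨
    b ∙ x ^ (t % m)                  ≡⟨ ≡.cong (λ n → b ∙ x ^ n) (Fin.toℕ-fromℕ< (m%n<n t m)) ⟨
    b ∙ x ^ toℕ (fromℕ< (m%n<n t m)) ∎))

  abelianGroupₓ : AbelianGroup 0ℓ 0ℓ
  abelianGroupₓ = record
    { _≈_ = _≈ₓ_
    ; _∙_ = _∙_
    ; ε = ε
    ; _⁻¹ = _⁻¹
    ; isAbelianGroup = isAbelianGroupˡ record
      { isSemigroup = record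
        { isMagma = record
          { isEquivalence = record { refl = ≈⇒≈ₓ refl ; sym = ≈ₓ-sym ; trans = ≈ₓ-trans }
          ; ∙-cong = ∙-congₓ
          }
        ; assoc = λ a b c → ≈⇒≈ₓ (assoc a b c)
        }
      ; identityˡ = λ a → ≈⇒≈ₓ (identityˡ a)
      ; inverseˡ = λ a → ≈⇒≈ₓ (inverseˡ a)
      ; comm = λ a b → ≈⇒≈ₓ (comm a b)
      }
    }

  open Representatives (representatives (AbelianGroup.setoid abelianGroupₓ) _≟ₓ_ enum)
    renaming (count to k; rep to r; rep-injective to r-injective; rep-cover to r-cover)

  quotient : FiniteAbelianGroup
  quotient = record
    { abelianGroup = abelianGroupₓ
    ; size = k
    ; enum = r
    ; isEnumeration = r-injective , λ y →
        let j , eᵢ≈ₓrⱼ = r-cover (index y)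
        in j , ≈ₓ-trans (≈⇒≈ₓ (proj₂ (enum-surjective y))) eᵢ≈ₓrⱼ
    }

  lagrange : size ≡ FiniteAbelianGroup.size quotient * m
  lagrange = enumeration-size-unique setoid isEnumeration (coset-injective , coset-surjective)
    where
    open import Algebra.Properties.Group group using (∙-cancelˡ)

    coset : Fin k × Fin m → Carrier
    coset (i , j) = r i ∙ x ^ toℕ j

    pair-injective : ∀ {i j i′ j′} → coset (i , j) ≈ coset (i′ , j′) → (i , j) ≡ (i′ , j′)
    pair-injective {i} {j} {i′} {j′} eq with r-injective i i′ (∙^≈∙^⇒≈ₓ (toℕ j) (toℕ j′) eq)
    ... | ≡.refl = ≡.cong (i ,_) (Fin.toℕ-injective
            (^-injective (Fin.toℕ<n j) (Fin.toℕ<n j′) (∙-cancelˡ (r i) _ _ eq)))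

    coset-injective : ∀ t t′ → coset (remQuot m t) ≈ coset (remQuot m t′) → t ≡ t′
    coset-injective t t′ eq = ≡.trans (≡.sym (Fin.combine-remQuot {k} m t))
      (≡.trans (≡.cong (uncurry combine) (pair-injective eq)) (Fin.combine-remQuot {k} m t′))

    coset-surjective : ∀ y → ∃ λ t → y ≈ coset (remQuot m t)
    coset-surjective y with r-cover (index y)
    ... | j , s , eᵢ≈rⱼxˢ = combine j l , (begin
      y                                ≈⟨ proj₂ (enum-surjective y) ⟩
      enum (index y)                   ≈⟨ eᵢ≈rⱼxˢ ⟩
      r j ∙ x ^ s                      ≈⟨ ∙-congˡ (^%≈^ annihilates s) ⟨
      r j ∙ x ^ (s % m)                ≡⟨ ≡.cong (λ n → r j ∙ x ^ n) (Fin.toℕ-fromℕ< (m%n<n s m)) ⟨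
      coset (j , l)                    ≡⟨ ≡.cong coset (Fin.remQuot-combine j l) ⟨
      coset (remQuot m (combine j l))  ∎)
      where
      l : Fin m
      l = fromℕ< (m%n<n s m)

  quotient-^ : ∀ y n → FiniteAbelianGroupProperties._^_ quotient y n ≡ y ^ n
  quotient-^ y zero = ≡.refl
  quotient-^ y (suc n) = ≡.cong (y ∙_) (quotient-^ y n)

  ≈ₓε⇒^≈ε : ∀ {y} → y ≈ₓ ε → y ^ m ≈ ε
  ≈ₓε⇒^≈ε {y} (s , y≈εxˢ) = begin
    y ^ m              ≈⟨ ^-cong m (trans y≈εxˢ (identityˡ _)) ⟩
    (x ^ s) ^ m        ≈⟨ ^-comm x s m ⟩
    (x ^ m) ^ s        ≈⟨ ^-cong s annihilates ⟩
    ε ^ s              ≈⟨ ε^n≈ε s ⟩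
    ε                  ∎

module _ (A : FiniteAbelianGroup) where
  open FiniteAbelianGroup A
  open FiniteAbelianGroupProperties A
  open import Relation.Binary.Reasoning.Setoid setoid

  ^size≈ε : ∀ x → x ^ size ≈ ε
  ^size≈ε x with m , o ← order x = begin
    x ^ size       ≡⟨ ≡.cong (x ^_) lagrange ⟩
    x ^ (k * m)    ≈⟨ ^≈ε⇒^*≈ε {x} {m} (IsOrder.annihilates o) k ⟩
    ε              ∎
    where
    open CyclicQuotient A o using (quotient; lagrange)
    k : ℕ
    k = FiniteAbelianGroup.size quotient

-- Cauchy's theorem and nontrivial homomorphisms

module CauchyStep (A : FiniteAbelianGroup) {q} (q-prime : Prime q)
  (cauchy-smaller : ∀ B → FiniteAbelianGroup.size B < FiniteAbelianGroup.size A →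
    q ∣ FiniteAbelianGroup.size B → FiniteAbelianGroupProperties.HasElementOfOrder B q) where
  open FiniteAbelianGroup A
  open FiniteAbelianGroupProperties A
  open import Relation.Binary.Reasoning.Setoid setoid

  private
    q>1 : 1 < q
    q>1 = nonTrivial⇒n>1 q {{prime⇒nonTrivial q-prime}}

    divisible⇒size≢1 : q ∣ size → size ≢ 1
    divisible⇒size≢1 q∣size size≡1 = ℕ.<⇒≢ q>1 (≡.sym (∣1⇒≡1 (≡.subst (q ∣_) size≡1 q∣size)))

  power-of-order : ∀ {x m d} → IsOrder x m → m ≡ d * q → HasElementOfOrder q
  power-of-order {x} {m} {d} o m≡dq = x ^ d , xᵈ^q≈ε , minimal d 0<d d<m
    where
    open IsOrder o
    xᵈ^q≈ε : (x ^ d) ^ q ≈ ε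
    xᵈ^q≈ε = begin
      (x ^ d) ^ q       ≈⟨ ^-* x q d ⟨
      x ^ (q * d)       ≡⟨ ≡.cong (x ^_) (≡.trans (ℕ.*-comm q d) (≡.sym m≡dq)) ⟩
      x ^ m             ≈⟨ annihilates ⟩
      ε                 ∎
    0<d : 0 < d
    0<d = ℕ.n≢0⇒n>0 (λ { ≡.refl → ℕ.<⇒≢ positive (≡.sym m≡dq) })
    d<m : d < m
    d<m = ≡.subst (d <_) (≡.sym m≡dq) (ℕ.m<m*n d q {{>-nonZero 0<d}} q>1)

  lift-from-quotient : ∀ {x m} → ¬ x ≈ ε → IsOrder x m → ¬ q ∣ m → q ∣ size → HasElementOfOrder q
  lift-from-quotient {x} {m} x≉ε o q∤m q∣size = lift (cauchy-smaller quotient k<size q∣k)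
    where
    open CyclicQuotient A o
    module Q = FiniteAbelianGroupProperties quotient
    k : ℕ
    k = FiniteAbelianGroup.size quotient
    q∣k : q ∣ k
    q∣k with euclidsLemma k m q-prime (≡.subst (q ∣_) lagrange q∣size)
    ... | inj₁ q∣k = q∣k
    ... | inj₂ q∣m = ⊥-elim (q∤m q∣m)
    k<size : k < size
    k<size = ≡.subst (k <_) (≡.sym lagrange)
      (ℕ.m<m*n k m {{>-nonZero (Q.size>0)}} (nontrivial⇒order≥2 x≉ε o))
    lift : Q.HasElementOfOrder q → HasElementOfOrder q
    lift (y , yᵠ≈ₓε , y≉ₓε) = y ^ m , yᵐ^q≈ε , yᵐ≉ε
      where
      yᵐ^q≈ε : (y ^ m) ^ q ≈ ε
      yᵐ^q≈ε = trans (^-comm y m q) (≈ₓε⇒^≈ε (≡.subst (_≈ₓ ε) (quotient-^ y q) yᵠ≈ₓε))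
      yᵐ≉ε : ¬ y ^ m ≈ ε
      yᵐ≉ε yᵐ≈ε = y≉ₓε (Q.coprime-exponents⇒≈ε yᵠ≈ₓε
        (≡.subst (_≈ₓ ε) (≡.sym (quotient-^ y m)) (≈⇒≈ₓ yᵐ≈ε)) (prime∤⇒coprime q-prime q∤m))

  step : q ∣ size → HasElementOfOrder q
  step q∣size with nontrivial-element (divisible⇒size≢1 q∣size)
  ... | x , x≉ε with m , o ← order x with q ∣? m
  ...   | yes (divides d m≡dq) = power-of-order {d = d} o m≡dq
  ...   | no q∤m = lift-from-quotient x≉ε o q∤m q∣size

cauchy : ∀ (A : FiniteAbelianGroup) {q} → Prime q → q ∣ FiniteAbelianGroup.size A →
  FiniteAbelianGroupProperties.HasElementOfOrder A q
cauchy A {q} q-prime = go A (<-wellFounded _)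
  where
  go : ∀ B → Acc _<_ (FiniteAbelianGroup.size B) → q ∣ FiniteAbelianGroup.size B →
    FiniteAbelianGroupProperties.HasElementOfOrder B q
  go B (acc smaller) = CauchyStep.step B q-prime (λ C C<B → go C (smaller C<B))

module _ (A B : FiniteAbelianGroup) where
  private
    module A = FiniteAbelianGroup A
    module B = FiniteAbelianGroup B

  IsHomomorphism : (A.Carrier → B.Carrier) → Set
  IsHomomorphism = MagmaMorphisms.IsMagmaHomomorphism A.rawMagma B.rawMagma

  NontrivialHomomorphism : Set
  NontrivialHomomorphism = Σ (A.Carrier → B.Carrier) λ f → IsHomomorphism f × ∃ λ t → ¬ f t B.≈ B.ε

module HomomorphismProperties {A B : FiniteAbelianGroup} {f} (hom : IsHomomorphism A B f) where
  private
    module A = FiniteAbelianGroup A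
    module B = FiniteAbelianGroup B
    module A′ = FiniteAbelianGroupProperties A
    module B′ = FiniteAbelianGroupProperties B
  open MagmaMorphisms.IsMagmaHomomorphism hom
  open import Algebra.Properties.Group B.group using (identityˡ-unique)
  open import Relation.Binary.Reasoning.Setoid B.setoid

  ε-homo : f A.ε B.≈ B.ε
  ε-homo = identityˡ-unique (f A.ε) (f A.ε) (B.trans (B.sym (homo A.ε A.ε)) (⟦⟧-cong (A.identityˡ A.ε)))

  ^-homo : ∀ x n → f (x A′.^ n) B.≈ f x B′.^ n
  ^-homo x zero = ε-homo
  ^-homo x (suc n) = B.trans (homo x (x A′.^ n)) (B.∙-congˡ (^-homo x n))

  coprime⇒trivial : Coprime A.size B.size → ∀ x → f x B.≈ B.ε
  coprime⇒trivial sizes-coprime x = B′.coprime-exponents⇒≈ε fx^|A|≈ε (^size≈ε B (f x)) sizes-coprime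
    where
    fx^|A|≈ε : f x B′.^ A.size B.≈ B.ε
    fx^|A|≈ε = begin
      f x B′.^ A.size      ≈⟨ ^-homo x A.size ⟨
      f (x A′.^ A.size)    ≈⟨ ⟦⟧-cong (^size≈ε A x) ⟩
      f A.ε                ≈⟨ ε-homo ⟩
      B.ε                  ∎

module CharacterStep (A B : FiniteAbelianGroup) {q} (q-prime : Prime q)
  {w : FiniteAbelianGroup.Carrier B} (w-order : FiniteAbelianGroupProperties.IsOrder B w q)
  (character-smaller : ∀ C → FiniteAbelianGroup.size C < FiniteAbelianGroup.size A →
    q ∣ FiniteAbelianGroup.size C → NontrivialHomomorphism C B) where
  open FiniteAbelianGroup A
  open FiniteAbelianGroupProperties A
  private
    module B = FiniteAbelianGroup B
    module B′ = FiniteAbelianGroupProperties B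
  open import Relation.Binary.Reasoning.Setoid setoid

  module _ {y} (y-order : IsOrder y q) where
    open CyclicQuotient A y-order
    private
      module Q = FiniteAbelianGroupProperties quotient
      k : ℕ
      k = FiniteAbelianGroup.size quotient

      k<size : k < size
      k<size = ≡.subst (k <_) (≡.sym lagrange) (ℕ.m<m*n k q {{>-nonZero Q.size>0}}
        (nonTrivial⇒n>1 q {{prime⇒nonTrivial q-prime}}))

    lift-character : q ∣ k → NontrivialHomomorphism A B
    lift-character q∣k with character-smaller quotient k<size q∣k
    ... | f , hom , t , ft≉ε = f , record
      { isRelHomomorphism = record { cong = ⟦⟧-cong ∘ ≈⇒≈ₓ }
      ; homo = homo
      } , t , ft≉ε
      where open MagmaMorphisms.IsMagmaHomomorphism hom

    private
      powers-transfer : ∀ i j → y ^ i ≈ y ^ j → w B′.^ i B.≈ w B′.^ j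
      powers-transfer i j = Equivalence.from (B′.IsOrder.^≈^⇔%≡% w-order i j)
        ∘ Equivalence.to (IsOrder.^≈^⇔%≡% y-order i j)

      powers-reflect : ∀ i j → w B′.^ i B.≈ w B′.^ j → y ^ i ≈ y ^ j
      powers-reflect i j = Equivalence.from (IsOrder.^≈^⇔%≡% y-order i j)
        ∘ Equivalence.to (B′.IsOrder.^≈^⇔%≡% w-order i j)

      -- x ^ k lies in ⟨ y ⟩ because k is the order of the quotient by ⟨ y ⟩.
      -- Abstract, as unfolding this witness makes type checking blow up.
      abstract
        discrete-log : ∀ x → ∃ λ s → x ^ k ≈ y ^ s
        discrete-log x =
          let s , xᵏ≈εyˢ = ≡.subst (_≈ₓ ε) (quotient-^ x k) (^size≈ε quotient x)
          in s , trans xᵏ≈εyˢ (identityˡ (y ^ s))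

      log : Carrier → ℕ
      log x = proj₁ (discrete-log x)

      ^k≈^log : ∀ x → x ^ k ≈ y ^ log x
      ^k≈^log x = proj₂ (discrete-log x)

      χ : Carrier → B.Carrier
      χ x = w B′.^ log x

      χ-cong : ∀ {a b} → a ≈ b → χ a B.≈ χ b
      χ-cong {a} {b} a≈b = powers-transfer (log a) (log b)
        (trans (sym (^k≈^log a)) (trans (^-cong k a≈b) (^k≈^log b)))

      χ-homo : ∀ a b → χ (a ∙ b) B.≈ χ a B.∙ χ b
      χ-homo a b = B.trans (powers-transfer (log (a ∙ b)) (log a + log b) (begin
        y ^ log (a ∙ b)             ≈⟨ ^k≈^log (a ∙ b) ⟨
        (a ∙ b) ^ k                 ≈⟨ ^-distrib-∙ a b k ⟩
        a ^ k ∙ b ^ k               ≈⟨ ∙-cong (^k≈^log a) (^k≈^log b) ⟩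
        y ^ log a ∙ y ^ log b       ≈⟨ ^-+ y (log a) (log b) ⟨
        y ^ (log a + log b)         ∎)) (B′.^-+ w (log a) (log b))

      χ-nontrivial : ¬ q ∣ k → ¬ χ y B.≈ B.ε
      χ-nontrivial q∤k χy≈ε = q∤k (IsOrder.order-∣ y-order
        (trans (^k≈^log y) (powers-reflect (log y) 0 χy≈ε)))

    discrete-log-character : ¬ q ∣ k → NontrivialHomomorphism A B
    discrete-log-character q∤k = χ , record
      { isRelHomomorphism = record { cong = χ-cong }
      ; homo = χ-homo
      } , y , χ-nontrivial q∤k

    character : NontrivialHomomorphism A B
    character with q ∣? k
    ... | yes q∣k = lift-character q∣k
    ... | no q∤k = discrete-log-character q∤k

  step : q ∣ size → NontrivialHomomorphism A B
  step q∣size with y , yᵠ≈ε , y≉ε ← cauchy A q-prime q∣size = character (isOrder-prime q-prime yᵠ≈ε y≉ε)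

nontrivial-homomorphism : ∀ (A B : FiniteAbelianGroup) {q} → Prime q →
  q ∣ FiniteAbelianGroup.size A → q ∣ FiniteAbelianGroup.size B → NontrivialHomomorphism A B
nontrivial-homomorphism A B {q} q-prime q∣|A| q∣|B|
  with w , wᵠ≈ε , w≉ε ← cauchy B q-prime q∣|B| = go A (<-wellFounded _) q∣|A|
  where
  w-order : FiniteAbelianGroupProperties.IsOrder B w q
  w-order = FiniteAbelianGroupProperties.isOrder-prime B q-prime wᵠ≈ε w≉ε
  go : ∀ C → Acc _<_ (FiniteAbelianGroup.size C) → q ∣ FiniteAbelianGroup.size C →
    NontrivialHomomorphism C B
  go C (acc smaller) = CharacterStep.step C B q-prime w-order (λ D D<C → go D (smaller D<C))

-- The groups (G/N)^ab and Z(N), and normalizers of R in W(G,N)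

module _ (G : FiniteGroup) (N : NormalSubgroup G) where
  open FiniteGroup G
  open NormalSubgroup N
  open IsGroup isGroup using (assoc; identityˡ; identityʳ; inverseˡ; inverseʳ)
  open ≡ using (refl; cong; cong₂; subst)
  open ≡.≡-Reasoning

  private
    group : Group 0ℓ 0ℓ
    group = record { isGroup = isGroup }

  open import Algebra.Properties.Group group
    using (⁻¹-involutive; ⁻¹-anti-homo-∙; ⁻¹-anti-homo-\\; ⁻¹-anti-homo-//; ε⁻¹≈ε; \\-leftDividesˡ; \\-leftDividesʳ;
           //-rightDividesˡ; //-rightDividesʳ; ∙-cancelˡ; ∙-cancelʳ; inverseˡ-unique; identityˡ-unique)

  infix 4 _~_ _≋_
  private
    _~_ : Rel Carrier 0ℓ
    _~_ = _~N_ G N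
    _≋_ : Rel Carrier 0ℓ
    _≋_ = _~Ab_ G N
    D : Carrier → Set
    D = InDerivedQ G N

  \\-chain : ∀ x y z → (x ⁻¹ ∙ y) ∙ (y ⁻¹ ∙ z) ≡ x ⁻¹ ∙ z
  \\-chain x y z = ≡.trans (assoc (x ⁻¹) y (y ⁻¹ ∙ z)) (cong (x ⁻¹ ∙_) (\\-leftDividesˡ y z))

  ≡⇒~ : ∀ {x y} → x ≡ y → x ~ y
  ≡⇒~ {x} refl = subst _∈N (≡.sym (inverseˡ x)) ε∈

  ~-sym : ∀ {x y} → x ~ y → y ~ x
  ~-sym {x} {y} x~y = subst _∈N (⁻¹-anti-homo-\\ x y) (⁻¹∈ x~y)

  ~-trans : ∀ {x y z} → x ~ y → y ~ z → x ~ z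
  ~-trans {x} {y} {z} x~y y~z = subst _∈N (\\-chain x y z) (∙∈ x~y y~z)

  ∈N⇒~∙ : ∀ x {n} → n ∈N → x ~ x ∙ n
  ∈N⇒~∙ x {n} n∈N = subst _∈N (≡.sym (\\-leftDividesʳ x n)) n∈N

  D-ε : D ε
  D-ε = one (≡⇒~ refl)

  D-∙ : ∀ {a b} → D a → D b → D (a ∙ b)
  D-∙ da db = mul da db (≡⇒~ refl)

  D-⁻¹ : ∀ {a} → D a → D (a ⁻¹)
  D-⁻¹ da = inv da (≡⇒~ refl)

  D-commutator : ∀ a b → D (commutator G a b)
  D-commutator a b = gen a b (≡⇒~ refl)

  D-conjugate : ∀ {d} g → D d → D (g ⁻¹ ∙ d ∙ g)
  D-conjugate {d} g dd = subst D d[d,g]≡g⁻¹dg (D-∙ dd (D-commutator d g))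
    where
    d[d,g]≡g⁻¹dg : d ∙ (d ⁻¹ ∙ g ⁻¹ ∙ d ∙ g) ≡ g ⁻¹ ∙ d ∙ g
    d[d,g]≡g⁻¹dg = begin
      d ∙ (d ⁻¹ ∙ g ⁻¹ ∙ d ∙ g)     ≡⟨ assoc d (d ⁻¹ ∙ g ⁻¹ ∙ d) g ⟨
      d ∙ (d ⁻¹ ∙ g ⁻¹ ∙ d) ∙ g     ≡⟨ cong (_∙ g) (assoc d (d ⁻¹ ∙ g ⁻¹) d) ⟨
      d ∙ (d ⁻¹ ∙ g ⁻¹) ∙ d ∙ g     ≡⟨ cong (λ t → t ∙ d ∙ g) (\\-leftDividesˡ d (g ⁻¹)) ⟩
      g ⁻¹ ∙ d ∙ g                   ∎

  ≡⇒≋ : ∀ {x y} → x ≡ y → x ≋ y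
  ≡⇒≋ {x} refl = subst D (≡.sym (inverseˡ x)) D-ε

  ~⇒≋ : ∀ {x y} → x ~ y → x ≋ y
  ~⇒≋ {x} {y} x~y = one (subst _∈N (≡.sym (identityʳ _)) (⁻¹∈ x~y))

  ≋-sym : ∀ {x y} → x ≋ y → y ≋ x
  ≋-sym {x} {y} x≋y = subst D (⁻¹-anti-homo-\\ x y) (D-⁻¹ x≋y)

  ≋-trans : ∀ {x y z} → x ≋ y → y ≋ z → x ≋ z
  ≋-trans {x} {y} {z} x≋y y≋z = subst D (\\-chain x y z) (D-∙ x≋y y≋z)

  ∙-cong-≋ : ∀ {x x′ y y′} → x ≋ x′ → y ≋ y′ → x ∙ y ≋ x′ ∙ y′
  ∙-cong-≋ {x} {x′} {y} {y′} x≋x′ y≋y′ = subst D eq (D-∙ (D-conjugate y x≋x′) y≋y′)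
    where
    eq : y ⁻¹ ∙ (x ⁻¹ ∙ x′) ∙ y ∙ (y ⁻¹ ∙ y′) ≡ (x ∙ y) ⁻¹ ∙ (x′ ∙ y′)
    eq = begin
      y ⁻¹ ∙ (x ⁻¹ ∙ x′) ∙ y ∙ (y ⁻¹ ∙ y′)    ≡⟨ assoc (y ⁻¹ ∙ (x ⁻¹ ∙ x′)) y (y ⁻¹ ∙ y′) ⟩
      y ⁻¹ ∙ (x ⁻¹ ∙ x′) ∙ (y ∙ (y ⁻¹ ∙ y′))  ≡⟨ cong (y ⁻¹ ∙ (x ⁻¹ ∙ x′) ∙_) (\\-leftDividesˡ y y′) ⟩
      y ⁻¹ ∙ (x ⁻¹ ∙ x′) ∙ y′                 ≡⟨ assoc (y ⁻¹) (x ⁻¹ ∙ x′) y′ ⟩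
      y ⁻¹ ∙ (x ⁻¹ ∙ x′ ∙ y′)                 ≡⟨ cong (y ⁻¹ ∙_) (assoc (x ⁻¹) x′ y′) ⟩
      y ⁻¹ ∙ (x ⁻¹ ∙ (x′ ∙ y′))               ≡⟨ assoc (y ⁻¹) (x ⁻¹) (x′ ∙ y′) ⟨
      y ⁻¹ ∙ x ⁻¹ ∙ (x′ ∙ y′)                 ≡⟨ cong (_∙ (x′ ∙ y′)) (⁻¹-anti-homo-∙ x y) ⟨
      (x ∙ y) ⁻¹ ∙ (x′ ∙ y′)                  ∎

  ≋-comm : ∀ x y → x ∙ y ≋ y ∙ x
  ≋-comm x y = subst D (≡.trans (assoc (y ⁻¹ ∙ x ⁻¹) y x) (cong (_∙ (y ∙ x)) (≡.sym (⁻¹-anti-homo-∙ x y))))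
    (D-commutator y x)

  abelianization : ∀ {a} → HasCard G _≋_ (λ _ → ⊤) a → FiniteAbelianGroup
  abelianization {a} (e , _ , e-injective , e-surjective) = record
    { abelianGroup = record
      { Carrier = Carrier
      ; _≈_ = _≋_
      ; _∙_ = _∙_
      ; ε = ε
      ; _⁻¹ = _⁻¹
      ; isAbelianGroup = isAbelianGroupˡ record
        { isSemigroup = record
          { isMagma = record
            { isEquivalence = record { refl = ≡⇒≋ refl ; sym = ≋-sym ; trans = ≋-trans }
            ; ∙-cong = ∙-cong-≋
            }
          ; assoc = λ x y z → ≡⇒≋ (assoc x y z)
          }
        ; identityˡ = λ x → ≡⇒≋ (identityˡ x)
        ; inverseˡ = λ x → ≡⇒≋ (inverseˡ x)
        ; comm = ≋-comm
        }
      }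
    ; size = a
    ; enum = e
    ; isEnumeration = e-injective , λ x → e-surjective x tt
    }

  private
    ZN : Set
    ZN = Σ Carrier (InZN G N)

  ∙-InZN : ∀ {x y} → InZN G N x → InZN G N y → InZN G N (x ∙ y)
  ∙-InZN {x} {y} (x∈N , x-comm) (y∈N , y-comm) = ∙∈ x∈N y∈N , λ n n∈N → begin
    x ∙ y ∙ n      ≡⟨ assoc x y n ⟩
    x ∙ (y ∙ n)    ≡⟨ cong (x ∙_) (y-comm n n∈N) ⟩
    x ∙ (n ∙ y)    ≡⟨ assoc x n y ⟨
    x ∙ n ∙ y      ≡⟨ cong (_∙ y) (x-comm n n∈N) ⟩
    n ∙ x ∙ y      ≡⟨ assoc n x y ⟩
    n ∙ (x ∙ y)    ∎

  ⁻¹-InZN : ∀ {x} → InZN G N x → InZN G N (x ⁻¹)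
  ⁻¹-InZN {x} (x∈N , x-comm) = ⁻¹∈ x∈N , λ n n∈N → begin
    x ⁻¹ ∙ n                 ≡⟨ cong (x ⁻¹ ∙_) (//-rightDividesʳ x n) ⟨
    x ⁻¹ ∙ (n ∙ x ∙ x ⁻¹)    ≡⟨ cong (λ t → x ⁻¹ ∙ (t ∙ x ⁻¹)) (x-comm n n∈N) ⟨
    x ⁻¹ ∙ (x ∙ n ∙ x ⁻¹)    ≡⟨ cong (x ⁻¹ ∙_) (assoc x n (x ⁻¹)) ⟩
    x ⁻¹ ∙ (x ∙ (n ∙ x ⁻¹))  ≡⟨ \\-leftDividesʳ x (n ∙ x ⁻¹) ⟩
    n ∙ x ⁻¹                 ∎

  ε-InZN : InZN G N ε
  ε-InZN = ε∈ , λ n _ → ≡.trans (identityˡ n) (≡.sym (identityʳ n))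

  centreOfN : ∀ {z} → HasCard G _≡_ (InZN G N) z → FiniteAbelianGroup
  centreOfN {z} (e , e∈ZN , e-injective , e-surjective) = record
    { abelianGroup = record
      { Carrier = ZN
      ; _≈_ = λ x y → proj₁ x ≡ proj₁ y
      ; _∙_ = λ (x , x∈ZN) (y , y∈ZN) → x ∙ y , ∙-InZN x∈ZN y∈ZN
      ; ε = ε , ε-InZN
      ; _⁻¹ = λ (x , x∈ZN) → x ⁻¹ , ⁻¹-InZN x∈ZN
      ; isAbelianGroup = isAbelianGroupˡ record
        { isSemigroup = record
          { isMagma = record
            { isEquivalence = record { refl = refl ; sym = ≡.sym ; trans = ≡.trans }
            ; ∙-cong = cong₂ _∙_
            }
          ; assoc = λ x y z → assoc (proj₁ x) (proj₁ y) (proj₁ z)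
          }
        ; identityˡ = λ x → identityˡ (proj₁ x)
        ; inverseˡ = λ x → inverseˡ (proj₁ x)
        ; comm = λ (x , _ , x-comm) (y , y∈N , _) → x-comm y y∈N
        }
      }
    ; size = z
    ; enum = λ i → e i , e∈ZN i
    ; isEnumeration = e-injective , λ (x , x∈ZN) → e-surjective x x∈ZN
    }

  normalizesR-by : ∀ {σ} (θ : Carrier → Carrier) → (∀ g x → σ (x ∙ g) ≡ σ x ∙ θ g) →
    (∀ h → ∃ λ g → θ g ≡ h) → NormalizesR G N σ
  normalizesR-by {σ} θ σ-twist θ-onto = (λ g → θ g , σ-twist g) , λ h →
    let g , θg≡h = θ-onto h in g , λ x → ≡.trans (σ-twist g x) (cong (σ x ∙_) θg≡h)

  φ-ε : ∀ f x → φ G N ε f x ≡ x ∙ f x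
  φ-ε f x = cong (_∙ f x) (identityʳ x)

  conjugate-coset-invariant : ∀ {a} → InZN G N a → ∀ {x y} → x ~ y → y ⁻¹ ∙ a ∙ y ≡ x ⁻¹ ∙ a ∙ x
  conjugate-coset-invariant {a} (_ , a-comm) {x} {y} x~y = begin
    y ⁻¹ ∙ a ∙ y                         ≡⟨ assoc (y ⁻¹) a y ⟩
    y ⁻¹ ∙ (a ∙ y)                       ≡⟨ cong (λ t → y ⁻¹ ∙ (a ∙ t)) (//-rightDividesˡ x y) ⟨
    y ⁻¹ ∙ (a ∙ (n ∙ x))                 ≡⟨ cong (y ⁻¹ ∙_) (assoc a n x) ⟨
    y ⁻¹ ∙ (a ∙ n ∙ x)                   ≡⟨ cong (λ t → y ⁻¹ ∙ (t ∙ x)) (a-comm n n∈N) ⟩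
    y ⁻¹ ∙ (n ∙ a ∙ x)                   ≡⟨ cong (y ⁻¹ ∙_) (assoc n a x) ⟩
    y ⁻¹ ∙ (n ∙ (a ∙ x))                 ≡⟨ cong (λ t → y ⁻¹ ∙ (n ∙ t)) (\\-leftDividesˡ x (a ∙ x)) ⟨
    y ⁻¹ ∙ (n ∙ (x ∙ (x ⁻¹ ∙ (a ∙ x))))  ≡⟨ cong (y ⁻¹ ∙_) (assoc n x _) ⟨
    y ⁻¹ ∙ (n ∙ x ∙ (x ⁻¹ ∙ (a ∙ x)))    ≡⟨ cong (λ t → y ⁻¹ ∙ (t ∙ _)) (//-rightDividesˡ x y) ⟩
    y ⁻¹ ∙ (y ∙ (x ⁻¹ ∙ (a ∙ x)))        ≡⟨ \\-leftDividesʳ y _ ⟩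
    x ⁻¹ ∙ (a ∙ x)                       ≡⟨ assoc (x ⁻¹) a x ⟨
    x ⁻¹ ∙ a ∙ x                         ∎
    where
    n : Carrier
    n = y ∙ x ⁻¹
    n∈N : n ∈N
    n∈N = subst (λ t → (t ∙ x ⁻¹) ∈N) (\\-leftDividesˡ x y) (normal x x~y)

  conjugateBy : Carrier → Carrier → Carrier
  conjugateBy a x = x ⁻¹ ∙ a ∙ x

  conjugation-IsQuotFun : ∀ {a} → InZN G N a → IsQuotFun G N (conjugateBy a)
  conjugation-IsQuotFun {a} a∈ZN@(a∈N , _) =
    (λ x → subst (λ t → (x ⁻¹ ∙ a ∙ t) ∈N) (⁻¹-involutive x) (normal (x ⁻¹) a∈N)) ,
    (λ x y x~y → ≡.sym (conjugate-coset-invariant a∈ZN x~y))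

  φ-conjugation : ∀ a x → φ G N ε (conjugateBy a) x ≡ a ∙ x
  φ-conjugation a x = begin
    x ∙ ε ∙ (x ⁻¹ ∙ a ∙ x)       ≡⟨ φ-ε (conjugateBy a) x ⟩
    x ∙ (x ⁻¹ ∙ a ∙ x)           ≡⟨ assoc x (x ⁻¹ ∙ a) x ⟨
    x ∙ (x ⁻¹ ∙ a) ∙ x           ≡⟨ cong (_∙ x) (\\-leftDividesˡ x a) ⟩
    a ∙ x                        ∎

  conjugation-normalizesR : ∀ a → NormalizesR G N (φ G N ε (conjugateBy a))
  conjugation-normalizesR a = normalizesR-by (λ g → g) twist (λ h → h , refl)
    where
    twist : ∀ g x → φ G N ε (conjugateBy a) (x ∙ g) ≡ φ G N ε (conjugateBy a) x ∙ g
    twist g x = begin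
      φ G N ε (conjugateBy a) (x ∙ g)   ≡⟨ φ-conjugation a (x ∙ g) ⟩
      a ∙ (x ∙ g)                       ≡⟨ assoc a x g ⟨
      a ∙ x ∙ g                         ≡⟨ cong (_∙ g) (φ-conjugation a x) ⟨
      φ G N ε (conjugateBy a) x ∙ g     ∎

  left-multiplication-right⇒central : ∀ {a g} → (∀ x → a ∙ x ≡ x ∙ g) → InZG G a
  left-multiplication-right⇒central {a} {g} ax≡xg x = ≡.trans (ax≡xg x) (cong (x ∙_) g≡a)
    where
    g≡a : g ≡ a
    g≡a = ≡.trans (≡.sym (identityˡ g)) (≡.trans (≡.sym (ax≡xg ε)) (identityʳ a))

  self-normalizing⇒centreOfN-central : SelfNormalizingInW G N → ∀ a → InZN G N a → InZG G a
  self-normalizing⇒centreOfN-central self-normalizing a a∈ZN =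
    let g , φ≡ρg = self-normalizing ε (conjugateBy a) (conjugation-IsQuotFun a∈ZN) (conjugation-normalizesR a)
    in left-multiplication-right⇒central (λ x → ≡.trans (≡.sym (φ-conjugation a x)) (φ≡ρg x))

  module CentralTwist (f : Carrier → Carrier) (f-quot : IsQuotFun G N f)
    (f-homo : ∀ x y → f (x ∙ y) ≡ f x ∙ f y) (f-central : ∀ x → InZG G (f x)) where

    twist : ∀ g x → φ G N ε f (x ∙ g) ≡ φ G N ε f x ∙ (g ∙ f g)
    twist g x = begin
      φ G N ε f (x ∙ g)        ≡⟨ φ-ε f (x ∙ g) ⟩
      x ∙ g ∙ f (x ∙ g)        ≡⟨ cong (x ∙ g ∙_) (f-homo x g) ⟩
      x ∙ g ∙ (f x ∙ f g)      ≡⟨ assoc (x ∙ g) (f x) (f g) ⟨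
      x ∙ g ∙ f x ∙ f g        ≡⟨ cong (_∙ f g) (assoc x g (f x)) ⟩
      x ∙ (g ∙ f x) ∙ f g      ≡⟨ cong (λ t → x ∙ t ∙ f g) (f-central x g) ⟨
      x ∙ (f x ∙ g) ∙ f g      ≡⟨ cong (_∙ f g) (assoc x (f x) g) ⟨
      x ∙ f x ∙ g ∙ f g        ≡⟨ assoc (x ∙ f x) g (f g) ⟩
      x ∙ f x ∙ (g ∙ f g)      ≡⟨ cong (_∙ (g ∙ f g)) (φ-ε f x) ⟨
      φ G N ε f x ∙ (g ∙ f g)  ∎

    twist-onto : ∀ h → ∃ λ g → g ∙ f g ≡ h
    twist-onto h = g , (begin
      g ∙ f g                  ≡⟨ cong (g ∙_) (proj₂ f-quot g h g~h) ⟩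
      h ∙ f h ⁻¹ ∙ f h         ≡⟨ //-rightDividesˡ (f h) h ⟩
      h                        ∎)
      where
      g : Carrier
      g = h ∙ f h ⁻¹
      g~h : g ~ h
      g~h = subst _∈N (≡.sym (≡.trans (cong (_∙ h) (⁻¹-anti-homo-// h (f h))) (//-rightDividesˡ h (f h))))
              (proj₁ f-quot h)

    normalizesR : NormalizesR G N (φ G N ε f)
    normalizesR = normalizesR-by (λ g → g ∙ f g) twist twist-onto

    self-normalizing⇒constant : SelfNormalizingInW G N → ∀ x → f x ≡ f ε
    self-normalizing⇒constant self-normalizing x = ≡.trans (f≡g x) (≡.sym (f≡g ε))
      where
      ρg : ∃ λ g → ∀ x → φ G N ε f x ≡ ρ G g x
      ρg = self-normalizing ε f f-quot normalizesR
      f≡g : ∀ x → f x ≡ proj₁ ρg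
      f≡g x = ∙-cancelˡ x (f x) (proj₁ ρg) (≡.trans (≡.sym (φ-ε f x)) (proj₂ ρg x))

  nontrivial-homomorphism⇒¬self-normalizing : ∀ {a z} (HA : HasCard G _≋_ (λ _ → ⊤) a)
    (HZ : HasCard G _≡_ (InZN G N) z) → (∀ x → InZN G N x → InZG G x) →
    NontrivialHomomorphism (abelianization HA) (centreOfN HZ) → ¬ SelfNormalizingInW G N
  nontrivial-homomorphism⇒¬self-normalizing HA HZ ZN⊆ZG (χ , χ-hom , t , χt≉ε) self-normalizing =
    χt≉ε (≡.trans (self-normalizing⇒constant self-normalizing t) ε-homo)
    where
    open MagmaMorphisms.IsMagmaHomomorphism χ-hom
    open HomomorphismProperties {abelianization HA} {centreOfN HZ} χ-hom using (ε-homo)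
    open CentralTwist (proj₁ ∘ χ) ((λ x → proj₁ (proj₂ (χ x))) , λ x y x~y → ⟦⟧-cong (~⇒≋ x~y))
      homo (λ x → ZN⊆ZG _ (proj₂ (χ x)))

  self-normalizing⇒coprime : ∀ {a z} (HA : HasCard G _≋_ (λ _ → ⊤) a) (HZ : HasCard G _≡_ (InZN G N) z) →
    SelfNormalizingInW G N → (∀ x → InZN G N x → InZG G x) → Coprime a z
  self-normalizing⇒coprime HA HZ self-normalizing ZN⊆ZG =
    no-common-prime⇒coprime {{>-nonZero (FiniteAbelianGroupProperties.size>0 (abelianization HA))}}
      λ q-prime q∣a q∣z → nontrivial-homomorphism⇒¬self-normalizing HA HZ ZN⊆ZG
        (nontrivial-homomorphism (abelianization HA) (centreOfN HZ) q-prime q∣a q∣z) self-normalizing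

  module CentralHomomorphism (u : Carrier → Carrier) (u-homo : ∀ x y → u (x ∙ y) ≡ u x ∙ u y)
    (u-central : ∀ x → InZG G (u x)) (u-coset : ∀ {x y} → x ~ y → u x ≡ u y) where

    u-ε : u ε ≡ ε
    u-ε = identityˡ-unique (u ε) (u ε) (≡.trans (≡.sym (u-homo ε ε)) (cong u (identityˡ ε)))

    u-⁻¹ : ∀ x → u (x ⁻¹) ≡ u x ⁻¹
    u-⁻¹ x = inverseˡ-unique (u (x ⁻¹)) (u x) (≡.trans (≡.sym (u-homo (x ⁻¹) x)) (≡.trans (cong u (inverseˡ x)) u-ε))

    u-commutator : ∀ a b → u (commutator G a b) ≡ ε
    u-commutator a b = begin
      u (a ⁻¹ ∙ b ⁻¹ ∙ a ∙ b)                 ≡⟨ u-homo (a ⁻¹ ∙ b ⁻¹ ∙ a) b ⟩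
      u (a ⁻¹ ∙ b ⁻¹ ∙ a) ∙ u b               ≡⟨ cong (_∙ u b) (u-homo (a ⁻¹ ∙ b ⁻¹) a) ⟩
      u (a ⁻¹ ∙ b ⁻¹) ∙ u a ∙ u b             ≡⟨ cong (λ t → t ∙ u a ∙ u b) (u-homo (a ⁻¹) (b ⁻¹)) ⟩
      u (a ⁻¹) ∙ u (b ⁻¹) ∙ u a ∙ u b         ≡⟨ cong (λ t → t ∙ u a ∙ u b) (cong₂ _∙_ (u-⁻¹ a) (u-⁻¹ b)) ⟩
      u a ⁻¹ ∙ u b ⁻¹ ∙ u a ∙ u b             ≡⟨ cong (_∙ u b) (u-central a (u a ⁻¹ ∙ u b ⁻¹)) ⟨
      u a ∙ (u a ⁻¹ ∙ u b ⁻¹) ∙ u b           ≡⟨ cong (_∙ u b) (\\-leftDividesˡ (u a) (u b ⁻¹)) ⟩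
      u b ⁻¹ ∙ u b                            ≡⟨ inverseˡ (u b) ⟩
      ε                                       ∎

    u-derived : ∀ {d} → D d → u d ≡ ε
    u-derived (gen a b d~[a,b]) = ≡.trans (u-coset d~[a,b]) (u-commutator a b)
    u-derived (one d~ε) = ≡.trans (u-coset d~ε) u-ε
    u-derived {d} (mul {a = a} {b} da db d~ab) = begin
      u d             ≡⟨ u-coset d~ab ⟩
      u (a ∙ b)       ≡⟨ u-homo a b ⟩
      u a ∙ u b       ≡⟨ cong₂ _∙_ (u-derived da) (u-derived db) ⟩
      ε ∙ ε           ≡⟨ identityˡ ε ⟩
      ε               ∎
    u-derived {d} (inv {a = a} da d~a⁻¹) = begin
      u d             ≡⟨ u-coset d~a⁻¹ ⟩
      u (a ⁻¹)        ≡⟨ u-⁻¹ a ⟩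
      u a ⁻¹          ≡⟨ cong _⁻¹ (u-derived da) ⟩
      ε ⁻¹            ≡⟨ ε⁻¹≈ε ⟩
      ε               ∎

    u-≋ : ∀ {x y} → x ≋ y → u x ≡ u y
    u-≋ {x} {y} x≋y = begin
      u x                    ≡⟨ identityʳ (u x) ⟨
      u x ∙ ε                ≡⟨ cong (u x ∙_) (u-derived x≋y) ⟨
      u x ∙ u (x ⁻¹ ∙ y)     ≡⟨ u-homo x (x ⁻¹ ∙ y) ⟨
      u (x ∙ (x ⁻¹ ∙ y))     ≡⟨ cong u (\\-leftDividesˡ x y) ⟩
      u y                    ∎

  module NormalizingElement (c : Carrier) (f : Carrier → Carrier) (f-quot : IsQuotFun G N f)
    (normalizes : ∀ g → ∃ λ h → ∀ x → φ G N c f (x ∙ g) ≡ φ G N c f x ∙ h) where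

    F : Carrier → Carrier
    F x = c ∙ f x

    k : Carrier
    k = F ε

    u : Carrier → Carrier
    u x = F x ∙ k ⁻¹

    F≡u∙k : ∀ x → F x ≡ u x ∙ k
    F≡u∙k x = ≡.sym (//-rightDividesˡ k (F x))

    u-ε : u ε ≡ ε
    u-ε = inverseʳ k

    u-coset : ∀ {x y} → x ~ y → u x ≡ u y
    u-coset {x} {y} x~y = cong (λ t → c ∙ t ∙ k ⁻¹) (proj₂ f-quot x y x~y)

    u-∈N : ∀ x → u x ∈N
    u-∈N x = subst _∈N eq (normal c (∙∈ (proj₁ f-quot x) (⁻¹∈ (proj₁ f-quot ε))))
      where
      eq : c ∙ (f x ∙ f ε ⁻¹) ∙ c ⁻¹ ≡ u x
      eq = begin
        c ∙ (f x ∙ f ε ⁻¹) ∙ c ⁻¹      ≡⟨ cong (_∙ c ⁻¹) (assoc c (f x) (f ε ⁻¹)) ⟨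
        c ∙ f x ∙ f ε ⁻¹ ∙ c ⁻¹        ≡⟨ assoc (c ∙ f x) (f ε ⁻¹) (c ⁻¹) ⟩
        c ∙ f x ∙ (f ε ⁻¹ ∙ c ⁻¹)      ≡⟨ cong (c ∙ f x ∙_) (⁻¹-anti-homo-∙ c (f ε)) ⟨
        u x                            ∎

    F-twist : ∀ g → ∃ λ h → ∀ x → g ∙ F (x ∙ g) ≡ F x ∙ h
    F-twist g = let h , φ-twist = normalizes g in h , λ x → ∙-cancelˡ x _ _ (begin
      x ∙ (g ∙ F (x ∙ g))     ≡⟨ assoc x g (F (x ∙ g)) ⟨
      x ∙ g ∙ F (x ∙ g)       ≡⟨ assoc (x ∙ g) c (f (x ∙ g)) ⟨
      φ G N c f (x ∙ g)       ≡⟨ φ-twist x ⟩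
      φ G N c f x ∙ h         ≡⟨ cong (_∙ h) (assoc x c (f x)) ⟩
      x ∙ F x ∙ h             ≡⟨ assoc x (F x) h ⟩
      x ∙ (F x ∙ h)           ∎)

    u-twist : ∀ g x → g ∙ u (x ∙ g) ≡ u x ∙ (g ∙ u g)
    u-twist g x = let h , F-h = F-twist g in ∙-cancelʳ k _ _ (begin
      g ∙ u (x ∙ g) ∙ k        ≡⟨ assoc g (u (x ∙ g)) k ⟩
      g ∙ (u (x ∙ g) ∙ k)      ≡⟨ cong (g ∙_) (F≡u∙k (x ∙ g)) ⟨
      g ∙ F (x ∙ g)            ≡⟨ F-h x ⟩
      F x ∙ h                  ≡⟨ cong (_∙ h) (F≡u∙k x) ⟩
      u x ∙ k ∙ h              ≡⟨ assoc (u x) k h ⟩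
      u x ∙ (k ∙ h)            ≡⟨ cong (u x ∙_) (F-h ε) ⟨
      u x ∙ (g ∙ F (ε ∙ g))    ≡⟨ cong (λ t → u x ∙ (g ∙ t)) (≡.trans (cong F (identityˡ g)) (F≡u∙k g)) ⟩
      u x ∙ (g ∙ (u g ∙ k))    ≡⟨ cong (u x ∙_) (assoc g (u g) k) ⟨
      u x ∙ (g ∙ u g ∙ k)      ≡⟨ assoc (u x) (g ∙ u g) k ⟨
      u x ∙ (g ∙ u g) ∙ k      ∎)

    u-∈N-trivial : ∀ {n} → n ∈N → u n ≡ ε
    u-∈N-trivial {n} n∈N = ≡.trans (u-coset (~-sym (subst (ε ~_) (identityˡ n) (∈N⇒~∙ ε n∈N)))) u-ε

    u-InZN : ∀ x → InZN G N (u x)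
    u-InZN x = u-∈N x , λ n n∈N → ≡.sym (begin
      n ∙ u x                  ≡⟨ cong (n ∙_) (u-coset (∈N⇒~∙ x n∈N)) ⟩
      n ∙ u (x ∙ n)            ≡⟨ u-twist n x ⟩
      u x ∙ (n ∙ u n)          ≡⟨ cong (λ t → u x ∙ (n ∙ t)) (u-∈N-trivial n∈N) ⟩
      u x ∙ (n ∙ ε)            ≡⟨ cong (u x ∙_) (identityʳ n) ⟩
      u x ∙ n                  ∎)

    u-homo : (∀ x → InZN G N x → InZG G x) → ∀ x g → u (x ∙ g) ≡ u x ∙ u g
    u-homo ZN⊆ZG x g = ∙-cancelˡ g _ _ (begin
      g ∙ u (x ∙ g)            ≡⟨ u-twist g x ⟩
      u x ∙ (g ∙ u g)          ≡⟨ assoc (u x) g (u g) ⟨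
      u x ∙ g ∙ u g            ≡⟨ cong (_∙ u g) (ZN⊆ZG (u x) (u-InZN x) g) ⟩
      g ∙ u x ∙ u g            ≡⟨ assoc g (u x) (u g) ⟩
      g ∙ (u x ∙ u g)          ∎)

  coprime⇒self-normalizing : ∀ {a z} (HA : HasCard G _≋_ (λ _ → ⊤) a) (HZ : HasCard G _≡_ (InZN G N) z) →
    (∀ x → InZN G N x → InZG G x) → Coprime a z → SelfNormalizingInW G N
  coprime⇒self-normalizing HA HZ ZN⊆ZG a⊥z c f f-quot (normalizes , _) = k , λ x → begin
    x ∙ c ∙ f x        ≡⟨ assoc x c (f x) ⟩
    x ∙ F x            ≡⟨ cong (x ∙_) (F≡u∙k x) ⟩
    x ∙ (u x ∙ k)      ≡⟨ cong (λ t → x ∙ (t ∙ k)) (coprime⇒trivial a⊥z x) ⟩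
    x ∙ (ε ∙ k)        ≡⟨ cong (x ∙_) (identityˡ k) ⟩
    x ∙ k              ∎
    where
    open NormalizingElement c f f-quot normalizes
    open CentralHomomorphism u (u-homo ZN⊆ZG) (λ x → ZN⊆ZG (u x) (u-InZN x)) u-coset using (u-≋)
    u-hom : IsHomomorphism (abelianization HA) (centreOfN HZ) (λ x → u x , u-InZN x)
    u-hom = record { isRelHomomorphism = record { cong = u-≋ } ; homo = u-homo ZN⊆ZG }
    open HomomorphismProperties {abelianization HA} {centreOfN HZ} u-hom using (coprime⇒trivial)

theorem4p9 : (G : FiniteGroup) (N : NormalSubgroup G) (a z : ℕ) →
    HasCard G (_~Ab_ G N) (λ _ → ⊤) a →
    HasCard G _≡_ (InZN G N) z →
    (SelfNormalizingInW G N ⇔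
      ((∀ x → InZN G N x → InZG G x) × Coprime a z))
theorem4p9 G N a z HA HZ = mk⇔ necessary sufficient
  where
  Conditions : Set
  Conditions = (∀ x → InZN G N x → InZG G x) × Coprime a z

  necessary : SelfNormalizingInW G N → Conditions
  necessary self-normalizing = ZN⊆ZG , self-normalizing⇒coprime G N HA HZ self-normalizing ZN⊆ZG
    where
    ZN⊆ZG : ∀ x → InZN G N x → InZG G x
    ZN⊆ZG = self-normalizing⇒centreOfN-central G N self-normalizing

  sufficient : Conditions → SelfNormalizingInW G N
  sufficient (ZN⊆ZG , a⊥z) = coprime⇒self-normalizing G N HA HZ ZN⊆ZG a⊥z
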